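{- Parallel reduction has the diamond property: for all terms $t_1,t_2,t_3$, if $t_1\Rightarrow t_2$ and $t_1\Rightarrow t_3$, then there exists a term $t_4$ such that $t_2\Rightarrow t_4$ and $t_3\Rightarrow t_4$.
   Context: Calculus $\lambda^{::}_{\mathtt{catch}}$ (untyped). Terms: $t,r,s ::= x \mid () \mid \mathtt{nil} \mid (::) \mid \mathtt{lrec} \mid \lambda x.r \mid t\,s \mid \mathtt{catch}\,\alpha\,t \mid \mathtt{throw}\,\alpha\,t$ ($x$ variables, $\alpha,\beta$ continuation variables; $\lambda x$ binds $x$, $\mathtt{catch}\,\alpha$ binds $\alpha$; terms modulo renaming of bound variables; application left-associative; $t::r$ abbreviates $(::)\,t\,r$). $\mathrm{FCV}$ = free continuation variables, $t[x:=r]$ capture-avoiding substitution. Values: $v,w ::= x \mid () \mid \mathtt{nil} \mid (::) \mid (::)\,v \mid (::)\,v\,w \mid \mathtt{lrec} \mid \mathtt{lrec}\,v \mid \mathtt{lrec}\,v\,w \mid \lambda x.r$. Compound contexts: $\vec E ::= \Box \mid \vec E\,t \mid v\,\vec E \mid \mathtt{throw}\,\alpha\,\vec E$, with $\vec E[s]$ the result of filling the hole with $s$. Parallel reduction $t\Rightarrow t'$ is inductively defined by: (1) $x\Rightarrow x$, $()\Rightarrow()$, $\mathtt{nil}\Rightarrow\mathtt{nil}$, $(::)\Rightarrow(::)$, $\mathtt{lrec}\Rightarrow\mathtt{lrec}$; (2) if $t\Rightarrow t'$ and $r\Rightarrow r'$ then $tr\Rightarrow t'r'$; (3) if $t\Rightarrow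 t'$ then $\lambda x.t\Rightarrow\lambda x.t'$; (4) if $t\Rightarrow t'$ then $\mathtt{catch}\,\alpha\,t\Rightarrow\mathtt{catch}\,\alpha\,t'$; (5) if $t\Rightarrow t'$ and $v\Rightarrow r$ ($v$ a value) then $(\lambda x.t)\,v\Rightarrow t'[x:=r]$; (6) if $t\Rightarrow t'$ then $\vec E[\mathtt{throw}\,\alpha\,t]\Rightarrow\mathtt{throw}\,\alpha\,t'$ for every compound context $\vec E$; (7) if $t\Rightarrow t'$ then $\mathtt{catch}\,\alpha\,(\mathtt{throw}\,\alpha\,t)\Rightarrow\mathtt{catch}\,\alpha\,t'$; (8) if $v\Rightarrow t$ and $\alpha\notin\{\beta\}\cup\mathrm{FCV}(v)$ then $\mathtt{catch}\,\alpha\,(\mathtt{throw}\,\beta\,v)\Rightarrow\mathtt{throw}\,\beta\,t$; (9) if $v\Rightarrow t$ and $\alpha\notin\mathrm{FCV}(v)$ then $\mathtt{catch}\,\alpha\,v\Rightarrow t$; (10) if $v_r\Rightarrow r$ then $\mathtt{lrec}\,v_r\,v_s\,\mathtt{nil}\Rightarrow r$; (11) if $v_r\Rightarrow r$, $v_s\Rightarrow s$, $v_h\Rightarrow h$, $v_t\Rightarrow t$ then $\mathtt{lrec}\,v_r\,v_s\,(v_h::v_t)\Rightarrow s\,h\,t\,(\mathtt{lrec}\,r\,s\,t)$ (all of $v_r,v_s,v_h,v_t$ values). -}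

module Defs where

-- Untyped calculus λ^{::}_catch, with bound variables represented by
-- de Bruijn indices (terms modulo α-renaming).  There are two sorts of
-- variables: term variables (bound by lam) and continuation variables
-- (bound by catch), each with its own index space.

open import Data.Nat using (ℕ; zero; suc)
open import Relation.Nullary using (¬_)

data Term : Set where
  var   : ℕ → Term
  unit  : Term
  nil   : Term
  cons  : Term
  lrec  : Term
  lam   : Term → Term         -- λ x. r   (binds term variable 0)
  app   : Term → Term → Term
  catch : Term → Term         -- catch α t (binds continuation variable 0)
  throw : ℕ → Term → Term

_∷ₜ_ : Term → Term → Term
t ∷ₜ r = app (app cons t) r

ext : (ℕ → ℕ) → ℕ → ℕ
ext ρ zero    = zero
ext ρ (suc n) = suc (ρ n)

tren : (ℕ → ℕ) → Term → Term
tren ρ (var x)     = var (ρ x)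
tren ρ unit        = unit
tren ρ nil         = nil
tren ρ cons        = cons
tren ρ lrec        = lrec
tren ρ (lam t)     = lam (tren (ext ρ) t)
tren ρ (app t s)   = app (tren ρ t) (tren ρ s)
tren ρ (catch t)   = catch (tren ρ t)
tren ρ (throw a t) = throw a (tren ρ t)

cren : (ℕ → ℕ) → Term → Term
cren ρ (var x)     = var x
cren ρ unit        = unit
cren ρ nil         = nil
cren ρ cons        = cons
cren ρ lrec        = lrec
cren ρ (lam t)     = lam (cren ρ t)
cren ρ (app t s)   = app (cren ρ t) (cren ρ s)
cren ρ (catch t)   = catch (cren (ext ρ) t)
cren ρ (throw a t) = throw (ρ a) (cren ρ t)

exts : (ℕ → Term) → ℕ → Term
exts σ zero    = var zero
exts σ (suc n) = tren suc (σ n)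

subst : (ℕ → Term) → Term → Term
subst σ (var x)     = σ x
subst σ unit        = unit
subst σ nil         = nil
subst σ cons        = cons
subst σ lrec        = lrec
subst σ (lam t)     = lam (subst (exts σ) t)
subst σ (app t s)   = app (subst σ t) (subst σ s)
subst σ (catch t)   = catch (subst (λ n → cren suc (σ n)) t)
subst σ (throw a t) = throw a (subst σ t)

single : Term → ℕ → Term
single r zero    = r
single r (suc n) = var n

_[0:=_] : Term → Term → Term
t [0:= r ] = subst (single r) t

data _∈FCV_ : ℕ → Term → Set where
  fcv-appˡ  : ∀ {a t s} → a ∈FCV t → a ∈FCV app t s
  fcv-appʳ  : ∀ {a t s} → a ∈FCV s → a ∈FCV app t s
  fcv-lam   : ∀ {a t} → a ∈FCV t → a ∈FCV lam t
  fcv-catch : ∀ {a t} → suc a ∈FCV t → a ∈FCV catch t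
  fcv-throw : ∀ {a t} → a ∈FCV throw a t
  fcv-thrt  : ∀ {a b t} → a ∈FCV t → a ∈FCV throw b t

-- removing the (unused) continuation variable 0 from scope
lowerC : Term → Term
lowerC = cren (λ { zero → zero ; (suc n) → n })

data Value : Term → Set where
  v-var   : ∀ {x} → Value (var x)
  v-unit  : Value unit
  v-nil   : Value nil
  v-cons  : Value cons
  v-cons1 : ∀ {v} → Value v → Value (app cons v)
  v-cons2 : ∀ {v w} → Value v → Value w → Value (app (app cons v) w)
  v-lrec  : Value lrec
  v-lrec1 : ∀ {v} → Value v → Value (app lrec v)
  v-lrec2 : ∀ {v w} → Value v → Value w → Value (app (app lrec v) w)
  v-lam   : ∀ {r} → Value (lam r)

data CCtx : Set where
  hole   : CCtx
  appL   : CCtx → Term → CCtx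
  appR   : (v : Term) → Value v → CCtx → CCtx
  throwC : ℕ → CCtx → CCtx

plug : CCtx → Term → Term
plug hole         s = s
plug (appL E t)   s = app (plug E s) t
plug (appR v _ E) s = app v (plug E s)
plug (throwC a E) s = throw a (plug E s)

infix 4 _⇒_

data _⇒_ : Term → Term → Set where
  p-var   : ∀ {x} → var x ⇒ var x
  p-unit  : unit ⇒ unit
  p-nil   : nil ⇒ nil
  p-cons  : cons ⇒ cons
  p-lrec  : lrec ⇒ lrec
  p-app   : ∀ {t t' r r'} → t ⇒ t' → r ⇒ r' → app t r ⇒ app t' r'
  p-lam   : ∀ {t t'} → t ⇒ t' → lam t ⇒ lam t'
  p-catch : ∀ {t t'} → t ⇒ t' → catch t ⇒ catch t'
  p-beta  : ∀ {t t' v r} → Value v → t ⇒ t' → v ⇒ r →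
            app (lam t) v ⇒ t' [0:= r ]
  p-throw : ∀ {a t t'} (E : CCtx) → t ⇒ t' →
            plug E (throw a t) ⇒ throw a t'
  p-catchThrow : ∀ {t t'} → t ⇒ t' → catch (throw zero t) ⇒ catch t'
  p-catchThrowOther : ∀ {b v t} → Value v → ¬ (zero ∈FCV v) → v ⇒ t →
            catch (throw (suc b) v) ⇒ throw b (lowerC t)
  p-catchVal : ∀ {v t} → Value v → ¬ (zero ∈FCV v) → v ⇒ t →
            catch v ⇒ lowerC t
  p-lrecNil : ∀ {vr vs r} → Value vr → Value vs → vr ⇒ r →
            app (app (app lrec vr) vs) nil ⇒ r
  p-lrecCons : ∀ {vr vs vh vt r s h t} →
            Value vr → Value vs → Value vh → Value vt →
            vr ⇒ r → vs ⇒ s → vh ⇒ h → vt ⇒ t →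
            app (app (app lrec vr) vs) (vh ∷ₜ vt) ⇒
              app (app (app s h) t) (app (app (app lrec r) s) t)

-- Takahashi's method: every term t has a development t* with s ⇒ t* whenever t ⇒ s, so any two reducts
-- of t meet in t*.  The new difficulty is rule (6): a term E[throw α u] reduces both by moving the throw
-- outwards and inside u, and these reducts meet only if its development is itself a throw.  So t* is chosen
-- to be a throw whenever t is of that form, and this invariant is carried through the induction.
module Submission where

open import Defs
open import Data.Nat using (ℕ; zero; suc; _≟_)
open import Data.Product using (Σ; Σ-syntax; _×_; _,_; proj₁; proj₂)
open import Data.Sum using (_⊎_; inj₁; inj₂)
open import Data.Empty using (⊥-elim)
open import Function using (_∘_)
open import Relation.Nullary using (¬_; Dec; yes; no; _×-dec_; ¬?)
open import Relation.Binary.PropositionalEquality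
  using (_≡_; refl; sym; trans; cong; cong₂; module ≡-Reasoning)
  renaming (subst to transport)

ext-cong : ∀ {f g : ℕ → ℕ} → (∀ x → f x ≡ g x) → ∀ x → ext f x ≡ ext g x
ext-cong h zero    = refl
ext-cong h (suc x) = cong suc (h x)

ext-∘ : ∀ (f g : ℕ → ℕ) x → ext f (ext g x) ≡ ext (f ∘ g) x
ext-∘ f g zero    = refl
ext-∘ f g (suc x) = refl

tren-cong : ∀ {f g} → (∀ x → f x ≡ g x) → ∀ t → tren f t ≡ tren g t
tren-cong h (var x)     = cong var (h x)
tren-cong h unit        = refl
tren-cong h nil         = refl
tren-cong h cons        = refl
tren-cong h lrec        = refl
tren-cong h (lam t)     = cong lam (tren-cong (ext-cong h) t)
tren-cong h (app t s)   = cong₂ app (tren-cong h t) (tren-cong h s)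
tren-cong h (catch t)   = cong catch (tren-cong h t)
tren-cong h (throw a t) = cong (throw a) (tren-cong h t)

tren-∘ : ∀ f g t → tren f (tren g t) ≡ tren (f ∘ g) t
tren-∘ f g (var x)     = refl
tren-∘ f g unit        = refl
tren-∘ f g nil         = refl
tren-∘ f g cons        = refl
tren-∘ f g lrec        = refl
tren-∘ f g (lam t)     = cong lam (trans (tren-∘ (ext f) (ext g) t) (tren-cong (ext-∘ f g) t))
tren-∘ f g (app t s)   = cong₂ app (tren-∘ f g t) (tren-∘ f g s)
tren-∘ f g (catch t)   = cong catch (tren-∘ f g t)
tren-∘ f g (throw a t) = cong (throw a) (tren-∘ f g t)

cren-cong-FCV : ∀ {f g} t → (∀ a → a ∈FCV t → f a ≡ g a) → cren f t ≡ cren g t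
cren-cong-FCV (var x)     h = refl
cren-cong-FCV unit        h = refl
cren-cong-FCV nil         h = refl
cren-cong-FCV cons        h = refl
cren-cong-FCV lrec        h = refl
cren-cong-FCV (lam t)     h = cong lam (cren-cong-FCV t (λ a → h a ∘ fcv-lam))
cren-cong-FCV (app t s)   h =
  cong₂ app (cren-cong-FCV t (λ a → h a ∘ fcv-appˡ)) (cren-cong-FCV s (λ a → h a ∘ fcv-appʳ))
cren-cong-FCV {f} {g} (catch t) h = cong catch (cren-cong-FCV t h′)
  where
  h′ : ∀ a → a ∈FCV t → ext f a ≡ ext g a
  h′ zero    _ = refl
  h′ (suc a) m = cong suc (h a (fcv-catch m))
cren-cong-FCV (throw a t) h = cong₂ throw (h a fcv-throw) (cren-cong-FCV t (λ b → h b ∘ fcv-thrt))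

cren-cong : ∀ {f g} → (∀ x → f x ≡ g x) → ∀ t → cren f t ≡ cren g t
cren-cong h t = cren-cong-FCV t (λ a _ → h a)

cren-∘ : ∀ f g t → cren f (cren g t) ≡ cren (f ∘ g) t
cren-∘ f g (var x)     = refl
cren-∘ f g unit        = refl
cren-∘ f g nil         = refl
cren-∘ f g cons        = refl
cren-∘ f g lrec        = refl
cren-∘ f g (lam t)     = cong lam (cren-∘ f g t)
cren-∘ f g (app t s)   = cong₂ app (cren-∘ f g t) (cren-∘ f g s)
cren-∘ f g (catch t)   = cong catch (trans (cren-∘ (ext f) (ext g) t) (cren-cong (ext-∘ f g) t))
cren-∘ f g (throw a t) = cong (throw (f (g a))) (cren-∘ f g t)

cren-id : ∀ {f} → (∀ x → f x ≡ x) → ∀ t → cren f t ≡ t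
cren-id h t = trans (cren-cong h t) (cren-id′ t)
  where
  cren-id′ : ∀ t → cren (λ x → x) t ≡ t
  cren-id′ (var x)     = refl
  cren-id′ unit        = refl
  cren-id′ nil         = refl
  cren-id′ cons        = refl
  cren-id′ lrec        = refl
  cren-id′ (lam t)     = cong lam (cren-id′ t)
  cren-id′ (app t s)   = cong₂ app (cren-id′ t) (cren-id′ s)
  cren-id′ (catch t)   = cong catch (trans (cren-cong (λ { zero → refl ; (suc _) → refl }) t) (cren-id′ t))
  cren-id′ (throw a t) = cong (throw a) (cren-id′ t)

tren-cren : ∀ f g t → tren f (cren g t) ≡ cren g (tren f t)
tren-cren f g (var x)     = refl
tren-cren f g unit        = refl
tren-cren f g nil         = refl
tren-cren f g cons        = refl
tren-cren f g lrec        = refl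
tren-cren f g (lam t)     = cong lam (tren-cren (ext f) g t)
tren-cren f g (app t s)   = cong₂ app (tren-cren f g t) (tren-cren f g s)
tren-cren f g (catch t)   = cong catch (tren-cren f (ext g) t)
tren-cren f g (throw a t) = cong (throw (g a)) (tren-cren f g t)

exts-cong : ∀ {σ τ} → (∀ x → σ x ≡ τ x) → ∀ x → exts σ x ≡ exts τ x
exts-cong h zero    = refl
exts-cong h (suc x) = cong (tren suc) (h x)

subst-cong : ∀ {σ τ} → (∀ x → σ x ≡ τ x) → ∀ t → subst σ t ≡ subst τ t
subst-cong h (var x)     = h x
subst-cong h unit        = refl
subst-cong h nil         = refl
subst-cong h cons        = refl
subst-cong h lrec        = refl
subst-cong h (lam t)     = cong lam (subst-cong (exts-cong h) t)
subst-cong h (app t s)   = cong₂ app (subst-cong h t) (subst-cong h s)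
subst-cong h (catch t)   = cong catch (subst-cong (cong (cren suc) ∘ h) t)
subst-cong h (throw a t) = cong (throw a) (subst-cong h t)

subst-tren : ∀ σ ρ t → subst σ (tren ρ t) ≡ subst (σ ∘ ρ) t
subst-tren σ ρ (var x)     = refl
subst-tren σ ρ unit        = refl
subst-tren σ ρ nil         = refl
subst-tren σ ρ cons        = refl
subst-tren σ ρ lrec        = refl
subst-tren σ ρ (lam t)     = cong lam (trans (subst-tren (exts σ) (ext ρ) t) (subst-cong exts-ext t))
  where
  exts-ext : ∀ x → exts σ (ext ρ x) ≡ exts (σ ∘ ρ) x
  exts-ext zero    = refl
  exts-ext (suc x) = refl
subst-tren σ ρ (app t s)   = cong₂ app (subst-tren σ ρ t) (subst-tren σ ρ s)
subst-tren σ ρ (catch t)   = cong catch (subst-tren (cren suc ∘ σ) ρ t)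
subst-tren σ ρ (throw a t) = cong (throw a) (subst-tren σ ρ t)

tren-subst : ∀ ρ σ t → tren ρ (subst σ t) ≡ subst (tren ρ ∘ σ) t
tren-subst ρ σ (var x)     = refl
tren-subst ρ σ unit        = refl
tren-subst ρ σ nil         = refl
tren-subst ρ σ cons        = refl
tren-subst ρ σ lrec        = refl
tren-subst ρ σ (lam t)     = cong lam (trans (tren-subst (ext ρ) (exts σ) t) (subst-cong ext-exts t))
  where
  ext-exts : ∀ x → tren (ext ρ) (exts σ x) ≡ exts (tren ρ ∘ σ) x
  ext-exts zero    = refl
  ext-exts (suc x) = trans (tren-∘ (ext ρ) suc (σ x)) (sym (tren-∘ suc ρ (σ x)))
tren-subst ρ σ (app t s)   = cong₂ app (tren-subst ρ σ t) (tren-subst ρ σ s)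
tren-subst ρ σ (catch t)   =
  cong catch (trans (tren-subst ρ (cren suc ∘ σ) t) (subst-cong (tren-cren ρ suc ∘ σ) t))
tren-subst ρ σ (throw a t) = cong (throw a) (tren-subst ρ σ t)

cren-subst : ∀ ρ σ t → cren ρ (subst σ t) ≡ subst (cren ρ ∘ σ) (cren ρ t)
cren-subst ρ σ (var x)     = refl
cren-subst ρ σ unit        = refl
cren-subst ρ σ nil         = refl
cren-subst ρ σ cons        = refl
cren-subst ρ σ lrec        = refl
cren-subst ρ σ (lam t)     = cong lam (trans (cren-subst ρ (exts σ) t) (subst-cong cren-exts (cren ρ t)))
  where
  cren-exts : ∀ x → cren ρ (exts σ x) ≡ exts (cren ρ ∘ σ) x
  cren-exts zero    = refl
  cren-exts (suc x) = sym (tren-cren suc ρ (σ x))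
cren-subst ρ σ (app t s)   = cong₂ app (cren-subst ρ σ t) (cren-subst ρ σ s)
cren-subst ρ σ (catch t)   =
  cong catch (trans (cren-subst (ext ρ) (cren suc ∘ σ) t) (subst-cong cren-shift (cren (ext ρ) t)))
  where
  cren-shift : ∀ x → cren (ext ρ) (cren suc (σ x)) ≡ cren suc (cren ρ (σ x))
  cren-shift x = trans (cren-∘ (ext ρ) suc (σ x)) (sym (cren-∘ suc ρ (σ x)))
cren-subst ρ σ (throw a t) = cong (throw (ρ a)) (cren-subst ρ σ t)

subst-var : ∀ t → subst var t ≡ t
subst-var (var x)     = refl
subst-var unit        = refl
subst-var nil         = refl
subst-var cons        = refl
subst-var lrec        = refl
subst-var (lam t)     = cong lam (trans (subst-cong (λ { zero → refl ; (suc _) → refl }) t) (subst-var t))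
subst-var (app t s)   = cong₂ app (subst-var t) (subst-var s)
subst-var (catch t)   = cong catch (subst-var t)
subst-var (throw a t) = cong (throw a) (subst-var t)

subst-subst : ∀ σ τ t → subst σ (subst τ t) ≡ subst (subst σ ∘ τ) t
subst-subst σ τ (var x)     = refl
subst-subst σ τ unit        = refl
subst-subst σ τ nil         = refl
subst-subst σ τ cons        = refl
subst-subst σ τ lrec        = refl
subst-subst σ τ (lam t)     = cong lam (trans (subst-subst (exts σ) (exts τ) t) (subst-cong exts-subst t))
  where
  exts-subst : ∀ x → subst (exts σ) (exts τ x) ≡ exts (subst σ ∘ τ) x
  exts-subst zero    = refl
  exts-subst (suc x) = trans (subst-tren (exts σ) suc (τ x)) (sym (tren-subst suc σ (τ x)))
subst-subst σ τ (app t s)   = cong₂ app (subst-subst σ τ t) (subst-subst σ τ s)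
subst-subst σ τ (catch t)   =
  cong catch (trans (subst-subst (cren suc ∘ σ) (cren suc ∘ τ) t)
                    (subst-cong (sym ∘ cren-subst suc σ ∘ τ) t))
subst-subst σ τ (throw a t) = cong (throw a) (subst-subst σ τ t)

subst-[0:=] : ∀ τ t r → subst τ (t [0:= r ]) ≡ subst (exts τ) t [0:= subst τ r ]
subst-[0:=] τ t r = begin
  subst τ (subst (single r) t)                      ≡⟨ subst-subst τ (single r) t ⟩
  subst (subst τ ∘ single r) t                      ≡⟨ subst-cong agree t ⟩
  subst (subst (single (subst τ r)) ∘ exts τ) t     ≡⟨ subst-subst (single (subst τ r)) (exts τ) t ⟨
  subst (single (subst τ r)) (subst (exts τ) t)     ∎
  where
  open ≡-Reasoning
  agree : ∀ x → subst τ (single r x) ≡ subst (single (subst τ r)) (exts τ x)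
  agree zero    = refl
  agree (suc x) = sym (trans (subst-tren (single (subst τ r)) suc (τ x)) (subst-var (τ x)))

tren-[0:=] : ∀ ρ t r → tren ρ (t [0:= r ]) ≡ tren (ext ρ) t [0:= tren ρ r ]
tren-[0:=] ρ t r = begin
  tren ρ (subst (single r) t)                 ≡⟨ tren-subst ρ (single r) t ⟩
  subst (tren ρ ∘ single r) t                 ≡⟨ subst-cong agree t ⟩
  subst (single (tren ρ r) ∘ ext ρ) t         ≡⟨ subst-tren (single (tren ρ r)) (ext ρ) t ⟨
  subst (single (tren ρ r)) (tren (ext ρ) t)  ∎
  where
  open ≡-Reasoning
  agree : ∀ x → tren ρ (single r x) ≡ single (tren ρ r) (ext ρ x)
  agree zero    = refl
  agree (suc x) = refl

cren-[0:=] : ∀ ρ t r → cren ρ (t [0:= r ]) ≡ cren ρ t [0:= cren ρ r ]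
cren-[0:=] ρ t r = trans (cren-subst ρ (single r) t) (subst-cong agree (cren ρ t))
  where
  agree : ∀ x → cren ρ (single r x) ≡ single (cren ρ r) x
  agree zero    = refl
  agree (suc x) = refl

lower : ℕ → ℕ
lower zero    = zero
lower (suc n) = n

lowerC-cren : ∀ t → lowerC t ≡ cren lower t
lowerC-cren = cren-cong (λ { zero → refl ; (suc n) → refl })

tren-lowerC : ∀ ρ t → tren ρ (lowerC t) ≡ lowerC (tren ρ t)
tren-lowerC ρ = tren-cren ρ _

cren-lowerC : ∀ ρ t → ¬ (zero ∈FCV t) → cren ρ (lowerC t) ≡ lowerC (cren (ext ρ) t)
cren-lowerC ρ t 0∉t = begin
  cren ρ (lowerC t)            ≡⟨ cong (cren ρ) (lowerC-cren t) ⟩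
  cren ρ (cren lower t)        ≡⟨ cren-∘ ρ lower t ⟩
  cren (ρ ∘ lower) t           ≡⟨ cren-cong-FCV t agree ⟩
  cren (lower ∘ ext ρ) t       ≡⟨ cren-∘ lower (ext ρ) t ⟨
  cren lower (cren (ext ρ) t)  ≡⟨ lowerC-cren _ ⟨
  lowerC (cren (ext ρ) t)      ∎
  where
  open ≡-Reasoning
  agree : ∀ a → a ∈FCV t → ρ (lower a) ≡ lower (ext ρ a)
  agree zero    m = ⊥-elim (0∉t m)
  agree (suc a) _ = refl

subst-lowerC : ∀ τ t → subst τ (lowerC t) ≡ lowerC (subst (cren suc ∘ τ) t)
subst-lowerC τ t = sym (begin
  lowerC (subst (cren suc ∘ τ) t)                 ≡⟨ lowerC-cren _ ⟩
  cren lower (subst (cren suc ∘ τ) t)             ≡⟨ cren-subst lower (cren suc ∘ τ) t ⟩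
  subst (cren lower ∘ cren suc ∘ τ) (cren lower t) ≡⟨ subst-cong lower-suc (cren lower t) ⟩
  subst τ (cren lower t)                          ≡⟨ cong (subst τ) (lowerC-cren t) ⟨
  subst τ (lowerC t)                              ∎)
  where
  open ≡-Reasoning
  lower-suc : ∀ x → cren lower (cren suc (τ x)) ≡ τ x
  lower-suc x = trans (cren-∘ lower suc (τ x)) (cren-id (λ _ → refl) (τ x))

∈FCV-tren⁻ : ∀ {a} ρ t → a ∈FCV tren ρ t → a ∈FCV t
∈FCV-tren⁻ ρ (lam t)     (fcv-lam m)  = fcv-lam (∈FCV-tren⁻ (ext ρ) t m)
∈FCV-tren⁻ ρ (app t s)   (fcv-appˡ m) = fcv-appˡ (∈FCV-tren⁻ ρ t m)
∈FCV-tren⁻ ρ (app t s)   (fcv-appʳ m) = fcv-appʳ (∈FCV-tren⁻ ρ s m)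
∈FCV-tren⁻ ρ (catch t)   (fcv-catch m) = fcv-catch (∈FCV-tren⁻ ρ t m)
∈FCV-tren⁻ ρ (throw a t) fcv-throw    = fcv-throw
∈FCV-tren⁻ ρ (throw a t) (fcv-thrt m) = fcv-thrt (∈FCV-tren⁻ ρ t m)

∈FCV-cren⁻ : ∀ {a} ρ t → a ∈FCV cren ρ t → Σ[ b ∈ ℕ ] b ∈FCV t × ρ b ≡ a
∈FCV-cren⁻ ρ (lam t) (fcv-lam m) with ∈FCV-cren⁻ ρ t m
... | b , m′ , e = b , fcv-lam m′ , e
∈FCV-cren⁻ ρ (app t s) (fcv-appˡ m) with ∈FCV-cren⁻ ρ t m
... | b , m′ , e = b , fcv-appˡ m′ , e
∈FCV-cren⁻ ρ (app t s) (fcv-appʳ m) with ∈FCV-cren⁻ ρ s m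
... | b , m′ , e = b , fcv-appʳ m′ , e
∈FCV-cren⁻ ρ (catch t) (fcv-catch m) with ∈FCV-cren⁻ (ext ρ) t m
... | suc b , m′ , refl = b , fcv-catch m′ , refl
∈FCV-cren⁻ ρ (throw a t) fcv-throw = a , fcv-throw , refl
∈FCV-cren⁻ ρ (throw a t) (fcv-thrt m) with ∈FCV-cren⁻ ρ t m
... | b , m′ , e = b , fcv-thrt m′ , e

∈FCV-subst⁻ : ∀ {a} σ t → a ∈FCV subst σ t → a ∈FCV t ⊎ Σ[ n ∈ ℕ ] a ∈FCV σ n
∈FCV-subst⁻ σ (var x) m = inj₂ (x , m)
∈FCV-subst⁻ σ (lam t) (fcv-lam m) with ∈FCV-subst⁻ (exts σ) t m
... | inj₁ m′           = inj₁ (fcv-lam m′)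
... | inj₂ (suc n , m′) = inj₂ (n , ∈FCV-tren⁻ suc (σ n) m′)
∈FCV-subst⁻ σ (app t s) (fcv-appˡ m) with ∈FCV-subst⁻ σ t m
... | inj₁ m′ = inj₁ (fcv-appˡ m′)
... | inj₂ p  = inj₂ p
∈FCV-subst⁻ σ (app t s) (fcv-appʳ m) with ∈FCV-subst⁻ σ s m
... | inj₁ m′ = inj₁ (fcv-appʳ m′)
... | inj₂ p  = inj₂ p
∈FCV-subst⁻ σ (catch t) (fcv-catch m) with ∈FCV-subst⁻ (cren suc ∘ σ) t m
... | inj₁ m′ = inj₁ (fcv-catch m′)
... | inj₂ (n , m′) with ∈FCV-cren⁻ suc (σ n) m′
...   | _ , m″ , refl = inj₂ (n , m″)
∈FCV-subst⁻ σ (throw a t) fcv-throw = inj₁ fcv-throw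
∈FCV-subst⁻ σ (throw a t) (fcv-thrt m) with ∈FCV-subst⁻ σ t m
... | inj₁ m′ = inj₁ (fcv-thrt m′)
... | inj₂ p  = inj₂ p

0∉FCV-cren-ext : ∀ ρ v → ¬ (zero ∈FCV v) → ¬ (zero ∈FCV cren (ext ρ) v)
0∉FCV-cren-ext ρ v 0∉v m with ∈FCV-cren⁻ (ext ρ) v m
... | zero , m′ , _ = 0∉v m′

0∉FCV-subst-shift : ∀ σ v → ¬ (zero ∈FCV v) → ¬ (zero ∈FCV subst (cren suc ∘ σ) v)
0∉FCV-subst-shift σ v 0∉v m with ∈FCV-subst⁻ (cren suc ∘ σ) v m
... | inj₁ m′ = 0∉v m′
... | inj₂ (n , m′) with ∈FCV-cren⁻ suc (σ n) m′
...   | _ , _ , ()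

Value-tren : ∀ ρ {v} → Value v → Value (tren ρ v)
Value-tren ρ v-var         = v-var
Value-tren ρ v-unit        = v-unit
Value-tren ρ v-nil         = v-nil
Value-tren ρ v-cons        = v-cons
Value-tren ρ (v-cons1 v)   = v-cons1 (Value-tren ρ v)
Value-tren ρ (v-cons2 v w) = v-cons2 (Value-tren ρ v) (Value-tren ρ w)
Value-tren ρ v-lrec        = v-lrec
Value-tren ρ (v-lrec1 v)   = v-lrec1 (Value-tren ρ v)
Value-tren ρ (v-lrec2 v w) = v-lrec2 (Value-tren ρ v) (Value-tren ρ w)
Value-tren ρ v-lam         = v-lam

Value-cren : ∀ ρ {v} → Value v → Value (cren ρ v)
Value-cren ρ v-var         = v-var
Value-cren ρ v-unit        = v-unit
Value-cren ρ v-nil         = v-nil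
Value-cren ρ v-cons        = v-cons
Value-cren ρ (v-cons1 v)   = v-cons1 (Value-cren ρ v)
Value-cren ρ (v-cons2 v w) = v-cons2 (Value-cren ρ v) (Value-cren ρ w)
Value-cren ρ v-lrec        = v-lrec
Value-cren ρ (v-lrec1 v)   = v-lrec1 (Value-cren ρ v)
Value-cren ρ (v-lrec2 v w) = v-lrec2 (Value-cren ρ v) (Value-cren ρ w)
Value-cren ρ v-lam         = v-lam

Value-subst : ∀ {σ} → (∀ n → Value (σ n)) → ∀ {v} → Value v → Value (subst σ v)
Value-subst σᵛ (v-var {x})   = σᵛ x
Value-subst σᵛ v-unit        = v-unit
Value-subst σᵛ v-nil         = v-nil
Value-subst σᵛ v-cons        = v-cons
Value-subst σᵛ (v-cons1 v)   = v-cons1 (Value-subst σᵛ v)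
Value-subst σᵛ (v-cons2 v w) = v-cons2 (Value-subst σᵛ v) (Value-subst σᵛ w)
Value-subst σᵛ v-lrec        = v-lrec
Value-subst σᵛ (v-lrec1 v)   = v-lrec1 (Value-subst σᵛ v)
Value-subst σᵛ (v-lrec2 v w) = v-lrec2 (Value-subst σᵛ v) (Value-subst σᵛ w)
Value-subst σᵛ v-lam         = v-lam

infix 4 _⇛_

-- _⇛_ is _⇒_ with rule (6) unfolded one context frame at a time: ThrowsTo s a t′ says that s is
-- E[throw a u] for a compound context E and some u ⇛ t′.  HeadThrow s below says only that s is E[throw a u].
data _⇛_ : Term → Term → Set
data ThrowsTo : Term → ℕ → Term → Set

data _⇛_ where
  q-var   : ∀ {x} → var x ⇛ var x
  q-unit  : unit ⇛ unit
  q-nil   : nil ⇛ nil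
  q-cons  : cons ⇛ cons
  q-lrec  : lrec ⇛ lrec
  q-app   : ∀ {t t′ r r′} → t ⇛ t′ → r ⇛ r′ → app t r ⇛ app t′ r′
  q-lam   : ∀ {t t′} → t ⇛ t′ → lam t ⇛ lam t′
  q-catch : ∀ {t t′} → t ⇛ t′ → catch t ⇛ catch t′
  q-beta  : ∀ {t t′ v r} → Value v → t ⇛ t′ → v ⇛ r → app (lam t) v ⇛ t′ [0:= r ]
  q-throw : ∀ {s a t′} → ThrowsTo s a t′ → s ⇛ throw a t′
  q-catchThrow : ∀ {t t′} → t ⇛ t′ → catch (throw zero t) ⇛ catch t′
  q-catchThrowOther : ∀ {b v t} → Value v → ¬ (zero ∈FCV v) → v ⇛ t →
    catch (throw (suc b) v) ⇛ throw b (lowerC t)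
  q-catchVal : ∀ {v t} → Value v → ¬ (zero ∈FCV v) → v ⇛ t → catch v ⇛ lowerC t
  q-lrecNil : ∀ {vr vs r} → Value vr → Value vs → vr ⇛ r →
    app (app (app lrec vr) vs) nil ⇛ r
  q-lrecCons : ∀ {vr vs vh vt r s h t} →
    Value vr → Value vs → Value vh → Value vt →
    vr ⇛ r → vs ⇛ s → vh ⇛ h → vt ⇛ t →
    app (app (app lrec vr) vs) (vh ∷ₜ vt) ⇛ app (app (app s h) t) (app (app (app lrec r) s) t)

data ThrowsTo where
  th-here  : ∀ {a t t′} → t ⇛ t′ → ThrowsTo (throw a t) a t′
  th-appL  : ∀ {a t s t′} → ThrowsTo t a t′ → ThrowsTo (app t s) a t′
  th-appR  : ∀ {a v s t′} → Value v → ThrowsTo s a t′ → ThrowsTo (app v s) a t′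
  th-throw : ∀ {a b t t′} → ThrowsTo t a t′ → ThrowsTo (throw b t) a t′

plug-ThrowsTo : ∀ {a t t′} E → t ⇛ t′ → ThrowsTo (plug E (throw a t)) a t′
plug-ThrowsTo hole         d = th-here d
plug-ThrowsTo (appL E _)   d = th-appL (plug-ThrowsTo E d)
plug-ThrowsTo (appR _ v E) d = th-appR v (plug-ThrowsTo E d)
plug-ThrowsTo (throwC _ E) d = th-throw (plug-ThrowsTo E d)

⇒-to-⇛ : ∀ {t t′} → t ⇒ t′ → t ⇛ t′
⇒-to-⇛ p-var   = q-var
⇒-to-⇛ p-unit  = q-unit
⇒-to-⇛ p-nil   = q-nil
⇒-to-⇛ p-cons  = q-cons
⇒-to-⇛ p-lrec  = q-lrec
⇒-to-⇛ (p-app d e)   = q-app (⇒-to-⇛ d) (⇒-to-⇛ e)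
⇒-to-⇛ (p-lam d)     = q-lam (⇒-to-⇛ d)
⇒-to-⇛ (p-catch d)   = q-catch (⇒-to-⇛ d)
⇒-to-⇛ (p-beta v d e) = q-beta v (⇒-to-⇛ d) (⇒-to-⇛ e)
⇒-to-⇛ (p-throw E d) = q-throw (plug-ThrowsTo E (⇒-to-⇛ d))
⇒-to-⇛ (p-catchThrow d) = q-catchThrow (⇒-to-⇛ d)
⇒-to-⇛ (p-catchThrowOther v 0∉v d) = q-catchThrowOther v 0∉v (⇒-to-⇛ d)
⇒-to-⇛ (p-catchVal v 0∉v d) = q-catchVal v 0∉v (⇒-to-⇛ d)
⇒-to-⇛ (p-lrecNil vr vs d) = q-lrecNil vr vs (⇒-to-⇛ d)
⇒-to-⇛ (p-lrecCons vr vs vh vt dr ds dh dt) =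
  q-lrecCons vr vs vh vt (⇒-to-⇛ dr) (⇒-to-⇛ ds) (⇒-to-⇛ dh) (⇒-to-⇛ dt)

⇛-to-⇒ : ∀ {t t′} → t ⇛ t′ → t ⇒ t′
ThrowsTo-plug : ∀ {s a t′} → ThrowsTo s a t′ →
  Σ[ E ∈ CCtx ] Σ[ u ∈ Term ] s ≡ plug E (throw a u) × u ⇒ t′

⇛-to-⇒ q-var   = p-var
⇛-to-⇒ q-unit  = p-unit
⇛-to-⇒ q-nil   = p-nil
⇛-to-⇒ q-cons  = p-cons
⇛-to-⇒ q-lrec  = p-lrec
⇛-to-⇒ (q-app d e)    = p-app (⇛-to-⇒ d) (⇛-to-⇒ e)
⇛-to-⇒ (q-lam d)      = p-lam (⇛-to-⇒ d)
⇛-to-⇒ (q-catch d)    = p-catch (⇛-to-⇒ d)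
⇛-to-⇒ (q-beta v d e) = p-beta v (⇛-to-⇒ d) (⇛-to-⇒ e)
⇛-to-⇒ (q-throw th) with ThrowsTo-plug th
... | E , _ , refl , d = p-throw E d
⇛-to-⇒ (q-catchThrow d) = p-catchThrow (⇛-to-⇒ d)
⇛-to-⇒ (q-catchThrowOther v 0∉v d) = p-catchThrowOther v 0∉v (⇛-to-⇒ d)
⇛-to-⇒ (q-catchVal v 0∉v d) = p-catchVal v 0∉v (⇛-to-⇒ d)
⇛-to-⇒ (q-lrecNil vr vs d) = p-lrecNil vr vs (⇛-to-⇒ d)
⇛-to-⇒ (q-lrecCons vr vs vh vt dr ds dh dt) =
  p-lrecCons vr vs vh vt (⇛-to-⇒ dr) (⇛-to-⇒ ds) (⇛-to-⇒ dh) (⇛-to-⇒ dt)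

ThrowsTo-plug (th-here d) = hole , _ , refl , ⇛-to-⇒ d
ThrowsTo-plug (th-appL {s = s} th) with ThrowsTo-plug th
... | E , u , refl , d = appL E s , u , refl , d
ThrowsTo-plug (th-appR {v = v} v-val th) with ThrowsTo-plug th
... | E , u , refl , d = appR v v-val E , u , refl , d
ThrowsTo-plug (th-throw {b = b} th) with ThrowsTo-plug th
... | E , u , refl , d = throwC b E , u , refl , d

data HeadThrow : Term → Set where
  ht-here : ∀ {a t} → HeadThrow (throw a t)
  ht-appL : ∀ {t s} → HeadThrow t → HeadThrow (app t s)
  ht-appR : ∀ {v s} → Value v → HeadThrow s → HeadThrow (app v s)

Value⇒¬HeadThrow : ∀ {v} → Value v → ¬ HeadThrow v
Value⇒¬HeadThrow (v-cons1 v)   (ht-appR _ h) = Value⇒¬HeadThrow v h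
Value⇒¬HeadThrow (v-cons2 v w) (ht-appL h)   = Value⇒¬HeadThrow (v-cons1 v) h
Value⇒¬HeadThrow (v-cons2 v w) (ht-appR _ h) = Value⇒¬HeadThrow w h
Value⇒¬HeadThrow (v-lrec1 v)   (ht-appR _ h) = Value⇒¬HeadThrow v h
Value⇒¬HeadThrow (v-lrec2 v w) (ht-appL h)   = Value⇒¬HeadThrow (v-lrec1 v) h
Value⇒¬HeadThrow (v-lrec2 v w) (ht-appR _ h) = Value⇒¬HeadThrow w h

ThrowsTo⇒HeadThrow : ∀ {s a t} → ThrowsTo s a t → HeadThrow s
ThrowsTo⇒HeadThrow (th-here _)    = ht-here
ThrowsTo⇒HeadThrow (th-appL th)   = ht-appL (ThrowsTo⇒HeadThrow th)
ThrowsTo⇒HeadThrow (th-appR v th) = ht-appR v (ThrowsTo⇒HeadThrow th)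
ThrowsTo⇒HeadThrow (th-throw _)   = ht-here

Value⇒¬ThrowsTo : ∀ {v a t} → Value v → ¬ ThrowsTo v a t
Value⇒¬ThrowsTo v = Value⇒¬HeadThrow v ∘ ThrowsTo⇒HeadThrow

⇛-Value : ∀ {v w} → Value v → v ⇛ w → Value w
⇛-Value v (q-throw th) = ⊥-elim (Value⇒¬ThrowsTo v th)
⇛-Value v-var q-var   = v-var
⇛-Value v-unit q-unit = v-unit
⇛-Value v-nil q-nil   = v-nil
⇛-Value v-cons q-cons = v-cons
⇛-Value v-lrec q-lrec = v-lrec
⇛-Value v-lam (q-lam _) = v-lam
⇛-Value (v-cons1 v) (q-app q-cons d) = v-cons1 (⇛-Value v d)
⇛-Value (v-cons1 v) (q-app (q-throw ()) _)
⇛-Value (v-cons2 v w) (q-app (q-app q-cons d) e) = v-cons2 (⇛-Value v d) (⇛-Value w e)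
⇛-Value (v-cons2 v w) (q-app (q-app (q-throw ()) _) _)
⇛-Value (v-cons2 v w) (q-app (q-throw th) _) = ⊥-elim (Value⇒¬ThrowsTo (v-cons1 v) th)
⇛-Value (v-lrec1 v) (q-app q-lrec d) = v-lrec1 (⇛-Value v d)
⇛-Value (v-lrec1 v) (q-app (q-throw ()) _)
⇛-Value (v-lrec2 v w) (q-app (q-app q-lrec d) e) = v-lrec2 (⇛-Value v d) (⇛-Value w e)
⇛-Value (v-lrec2 v w) (q-app (q-app (q-throw ()) _) _)
⇛-Value (v-lrec2 v w) (q-app (q-throw th) _) = ⊥-elim (Value⇒¬ThrowsTo (v-lrec1 v) th)

⇛-HeadThrow : ∀ {s s′} → HeadThrow s → s ⇛ s′ → HeadThrow s′
⇛-HeadThrow h (q-throw _) = ht-here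
⇛-HeadThrow (ht-appL h) (q-app d e) = ht-appL (⇛-HeadThrow h d)
⇛-HeadThrow (ht-appR v h) (q-app d e) = ht-appR (⇛-Value v d) (⇛-HeadThrow h e)
⇛-HeadThrow (ht-appR _ h) (q-beta v _ _) = ⊥-elim (Value⇒¬HeadThrow v h)
⇛-HeadThrow (ht-appL h) (q-lrecNil vr vs _) = ⊥-elim (Value⇒¬HeadThrow (v-lrec2 vr vs) h)
⇛-HeadThrow (ht-appL h) (q-lrecCons vr vs _ _ _ _ _ _) = ⊥-elim (Value⇒¬HeadThrow (v-lrec2 vr vs) h)
⇛-HeadThrow (ht-appR _ h) (q-lrecCons _ _ vh vt _ _ _ _) = ⊥-elim (Value⇒¬HeadThrow (v-cons2 vh vt) h)

⇛throw⇒ThrowsTo : ∀ {s c w} → HeadThrow s → s ⇛ throw c w → ThrowsTo s c w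
⇛throw⇒ThrowsTo h d = go h d refl
  where
  go : ∀ {s x c w} → HeadThrow s → s ⇛ x → x ≡ throw c w → ThrowsTo s c w
  go h (q-throw th) refl = th
  go (ht-appR _ h) (q-beta v _ _) _ = ⊥-elim (Value⇒¬HeadThrow v h)
  go (ht-appL h) (q-lrecNil vr vs _) _ = ⊥-elim (Value⇒¬HeadThrow (v-lrec2 vr vs) h)

⇛-∈FCV⁻ : ∀ {t t′ a} → t ⇛ t′ → a ∈FCV t′ → a ∈FCV t
ThrowsTo-∈FCV⁻ : ∀ {s b t′ a} → ThrowsTo s b t′ → a ∈FCV throw b t′ → a ∈FCV s

⇛-∈FCV⁻ (q-app d e) (fcv-appˡ m) = fcv-appˡ (⇛-∈FCV⁻ d m)
⇛-∈FCV⁻ (q-app d e) (fcv-appʳ m) = fcv-appʳ (⇛-∈FCV⁻ e m)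
⇛-∈FCV⁻ (q-lam d) (fcv-lam m) = fcv-lam (⇛-∈FCV⁻ d m)
⇛-∈FCV⁻ (q-catch d) (fcv-catch m) = fcv-catch (⇛-∈FCV⁻ d m)
⇛-∈FCV⁻ (q-beta {t′ = t′} {r = r} _ d e) m with ∈FCV-subst⁻ (single r) t′ m
... | inj₁ m′          = fcv-appˡ (fcv-lam (⇛-∈FCV⁻ d m′))
... | inj₂ (zero , m′) = fcv-appʳ (⇛-∈FCV⁻ e m′)
⇛-∈FCV⁻ (q-throw th) m = ThrowsTo-∈FCV⁻ th m
⇛-∈FCV⁻ (q-catchThrow d) (fcv-catch m) = fcv-catch (fcv-thrt (⇛-∈FCV⁻ d m))
⇛-∈FCV⁻ (q-catchThrowOther _ _ _) fcv-throw = fcv-catch fcv-throw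
⇛-∈FCV⁻ (q-catchThrowOther {t = t} _ 0∉v d) (fcv-thrt m) with ∈FCV-cren⁻ _ t m
... | zero  , m′ , _    = ⊥-elim (0∉v (⇛-∈FCV⁻ d m′))
... | suc b , m′ , refl = fcv-catch (fcv-thrt (⇛-∈FCV⁻ d m′))
⇛-∈FCV⁻ (q-catchVal {t = t} _ 0∉v d) m with ∈FCV-cren⁻ _ t m
... | zero  , m′ , _    = ⊥-elim (0∉v (⇛-∈FCV⁻ d m′))
... | suc b , m′ , refl = fcv-catch (⇛-∈FCV⁻ d m′)
⇛-∈FCV⁻ (q-lrecNil _ _ d) m = fcv-appˡ (fcv-appˡ (fcv-appʳ (⇛-∈FCV⁻ d m)))
⇛-∈FCV⁻ (q-lrecCons _ _ _ _ dr ds dh dt) m = lrecCons-∈FCV⁻ m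
  where
  lrecCons-∈FCV⁻ : ∀ {a} → a ∈FCV _ → a ∈FCV _
  lrecCons-∈FCV⁻ (fcv-appˡ (fcv-appˡ (fcv-appˡ m))) = fcv-appˡ (fcv-appʳ (⇛-∈FCV⁻ ds m))
  lrecCons-∈FCV⁻ (fcv-appˡ (fcv-appˡ (fcv-appʳ m))) = fcv-appʳ (fcv-appˡ (fcv-appʳ (⇛-∈FCV⁻ dh m)))
  lrecCons-∈FCV⁻ (fcv-appˡ (fcv-appʳ m)) = fcv-appʳ (fcv-appʳ (⇛-∈FCV⁻ dt m))
  lrecCons-∈FCV⁻ (fcv-appʳ (fcv-appˡ (fcv-appˡ (fcv-appʳ m)))) =
    fcv-appˡ (fcv-appˡ (fcv-appʳ (⇛-∈FCV⁻ dr m)))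
  lrecCons-∈FCV⁻ (fcv-appʳ (fcv-appˡ (fcv-appʳ m))) = fcv-appˡ (fcv-appʳ (⇛-∈FCV⁻ ds m))
  lrecCons-∈FCV⁻ (fcv-appʳ (fcv-appʳ m)) = fcv-appʳ (fcv-appʳ (⇛-∈FCV⁻ dt m))

ThrowsTo-∈FCV⁻ (th-here d) fcv-throw    = fcv-throw
ThrowsTo-∈FCV⁻ (th-here d) (fcv-thrt m) = fcv-thrt (⇛-∈FCV⁻ d m)
ThrowsTo-∈FCV⁻ (th-appL th)   m = fcv-appˡ (ThrowsTo-∈FCV⁻ th m)
ThrowsTo-∈FCV⁻ (th-appR _ th) m = fcv-appʳ (ThrowsTo-∈FCV⁻ th m)
ThrowsTo-∈FCV⁻ (th-throw th)  m = fcv-thrt (ThrowsTo-∈FCV⁻ th m)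

⇛-tren : ∀ ρ {t t′} → t ⇛ t′ → tren ρ t ⇛ tren ρ t′
ThrowsTo-tren : ∀ ρ {s a t′} → ThrowsTo s a t′ → ThrowsTo (tren ρ s) a (tren ρ t′)

⇛-tren ρ q-var  = q-var
⇛-tren ρ q-unit = q-unit
⇛-tren ρ q-nil  = q-nil
⇛-tren ρ q-cons = q-cons
⇛-tren ρ q-lrec = q-lrec
⇛-tren ρ (q-app d e) = q-app (⇛-tren ρ d) (⇛-tren ρ e)
⇛-tren ρ (q-lam d)   = q-lam (⇛-tren (ext ρ) d)
⇛-tren ρ (q-catch d) = q-catch (⇛-tren ρ d)
⇛-tren ρ (q-beta {t′ = t′} {r = r} v d e) =
  transport (_ ⇛_) (sym (tren-[0:=] ρ t′ r)) (q-beta (Value-tren ρ v) (⇛-tren (ext ρ) d) (⇛-tren ρ e))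
⇛-tren ρ (q-throw th) = q-throw (ThrowsTo-tren ρ th)
⇛-tren ρ (q-catchThrow d) = q-catchThrow (⇛-tren ρ d)
⇛-tren ρ (q-catchThrowOther {b = b} {v = v} {t = t} vᵛ 0∉v d) =
  transport (λ z → _ ⇛ throw b z) (sym (tren-lowerC ρ t))
    (q-catchThrowOther (Value-tren ρ vᵛ) (0∉v ∘ ∈FCV-tren⁻ ρ v) (⇛-tren ρ d))
⇛-tren ρ (q-catchVal {v = v} {t = t} vᵛ 0∉v d) =
  transport (_ ⇛_) (sym (tren-lowerC ρ t))
    (q-catchVal (Value-tren ρ vᵛ) (0∉v ∘ ∈FCV-tren⁻ ρ v) (⇛-tren ρ d))
⇛-tren ρ (q-lrecNil vr vs d) = q-lrecNil (Value-tren ρ vr) (Value-tren ρ vs) (⇛-tren ρ d)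
⇛-tren ρ (q-lrecCons vr vs vh vt dr ds dh dt) =
  q-lrecCons (Value-tren ρ vr) (Value-tren ρ vs) (Value-tren ρ vh) (Value-tren ρ vt)
    (⇛-tren ρ dr) (⇛-tren ρ ds) (⇛-tren ρ dh) (⇛-tren ρ dt)

ThrowsTo-tren ρ (th-here d)    = th-here (⇛-tren ρ d)
ThrowsTo-tren ρ (th-appL th)   = th-appL (ThrowsTo-tren ρ th)
ThrowsTo-tren ρ (th-appR v th) = th-appR (Value-tren ρ v) (ThrowsTo-tren ρ th)
ThrowsTo-tren ρ (th-throw th)  = th-throw (ThrowsTo-tren ρ th)

⇛-cren : ∀ ρ {t t′} → t ⇛ t′ → cren ρ t ⇛ cren ρ t′
ThrowsTo-cren : ∀ ρ {s a t′} → ThrowsTo s a t′ → ThrowsTo (cren ρ s) (ρ a) (cren ρ t′)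

⇛-cren ρ q-var  = q-var
⇛-cren ρ q-unit = q-unit
⇛-cren ρ q-nil  = q-nil
⇛-cren ρ q-cons = q-cons
⇛-cren ρ q-lrec = q-lrec
⇛-cren ρ (q-app d e) = q-app (⇛-cren ρ d) (⇛-cren ρ e)
⇛-cren ρ (q-lam d)   = q-lam (⇛-cren ρ d)
⇛-cren ρ (q-catch d) = q-catch (⇛-cren (ext ρ) d)
⇛-cren ρ (q-beta {t′ = t′} {r = r} v d e) =
  transport (_ ⇛_) (sym (cren-[0:=] ρ t′ r)) (q-beta (Value-cren ρ v) (⇛-cren ρ d) (⇛-cren ρ e))
⇛-cren ρ (q-throw th) = q-throw (ThrowsTo-cren ρ th)
⇛-cren ρ (q-catchThrow d) = q-catchThrow (⇛-cren (ext ρ) d)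
⇛-cren ρ (q-catchThrowOther {b = b} {v = v} {t = t} vᵛ 0∉v d) =
  transport (λ z → _ ⇛ throw (ρ b) z) (sym (cren-lowerC ρ t (0∉v ∘ ⇛-∈FCV⁻ d)))
    (q-catchThrowOther (Value-cren (ext ρ) vᵛ) (0∉FCV-cren-ext ρ v 0∉v) (⇛-cren (ext ρ) d))
⇛-cren ρ (q-catchVal {v = v} {t = t} vᵛ 0∉v d) =
  transport (_ ⇛_) (sym (cren-lowerC ρ t (0∉v ∘ ⇛-∈FCV⁻ d)))
    (q-catchVal (Value-cren (ext ρ) vᵛ) (0∉FCV-cren-ext ρ v 0∉v) (⇛-cren (ext ρ) d))
⇛-cren ρ (q-lrecNil vr vs d) = q-lrecNil (Value-cren ρ vr) (Value-cren ρ vs) (⇛-cren ρ d)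
⇛-cren ρ (q-lrecCons vr vs vh vt dr ds dh dt) =
  q-lrecCons (Value-cren ρ vr) (Value-cren ρ vs) (Value-cren ρ vh) (Value-cren ρ vt)
    (⇛-cren ρ dr) (⇛-cren ρ ds) (⇛-cren ρ dh) (⇛-cren ρ dt)

ThrowsTo-cren ρ (th-here d)    = th-here (⇛-cren ρ d)
ThrowsTo-cren ρ (th-appL th)   = th-appL (ThrowsTo-cren ρ th)
ThrowsTo-cren ρ (th-appR v th) = th-appR (Value-cren ρ v) (ThrowsTo-cren ρ th)
ThrowsTo-cren ρ (th-throw th)  = th-throw (ThrowsTo-cren ρ th)

_⇛ˢ_ : (ℕ → Term) → (ℕ → Term) → Set
σ ⇛ˢ τ = (∀ n → Value (σ n)) × (∀ n → σ n ⇛ τ n)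

⇛ˢ-exts : ∀ {σ τ} → σ ⇛ˢ τ → exts σ ⇛ˢ exts τ
⇛ˢ-exts (σᵛ , σ⇛τ) = values , reductions
  where
  values : ∀ n → Value (exts _ n)
  values zero    = v-var
  values (suc n) = Value-tren suc (σᵛ n)
  reductions : ∀ n → exts _ n ⇛ exts _ n
  reductions zero    = q-var
  reductions (suc n) = ⇛-tren suc (σ⇛τ n)

⇛ˢ-shift : ∀ {σ τ} → σ ⇛ˢ τ → (cren suc ∘ σ) ⇛ˢ (cren suc ∘ τ)
⇛ˢ-shift (σᵛ , σ⇛τ) = Value-cren suc ∘ σᵛ , ⇛-cren suc ∘ σ⇛τ

⇛-subst : ∀ {σ τ} → σ ⇛ˢ τ → ∀ {t t′} → t ⇛ t′ → subst σ t ⇛ subst τ t′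
ThrowsTo-subst : ∀ {σ τ} → σ ⇛ˢ τ → ∀ {s a t′} → ThrowsTo s a t′ →
  ThrowsTo (subst σ s) a (subst τ t′)

⇛-subst R (q-var {x}) = proj₂ R x
⇛-subst R q-unit = q-unit
⇛-subst R q-nil  = q-nil
⇛-subst R q-cons = q-cons
⇛-subst R q-lrec = q-lrec
⇛-subst R (q-app d e) = q-app (⇛-subst R d) (⇛-subst R e)
⇛-subst R (q-lam d)   = q-lam (⇛-subst (⇛ˢ-exts R) d)
⇛-subst R (q-catch d) = q-catch (⇛-subst (⇛ˢ-shift R) d)
⇛-subst {τ = τ} R (q-beta {t′ = t′} {r = r} v d e) =
  transport (_ ⇛_) (sym (subst-[0:=] τ t′ r))
    (q-beta (Value-subst (proj₁ R) v) (⇛-subst (⇛ˢ-exts R) d) (⇛-subst R e))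
⇛-subst R (q-throw th) = q-throw (ThrowsTo-subst R th)
⇛-subst R (q-catchThrow d) = q-catchThrow (⇛-subst (⇛ˢ-shift R) d)
⇛-subst {σ} {τ} R (q-catchThrowOther {b = b} {v = v} {t = t} vᵛ 0∉v d) =
  transport (λ z → _ ⇛ throw b z) (sym (subst-lowerC τ t))
    (q-catchThrowOther (Value-subst (proj₁ (⇛ˢ-shift R)) vᵛ) (0∉FCV-subst-shift σ v 0∉v)
      (⇛-subst (⇛ˢ-shift R) d))
⇛-subst {σ} {τ} R (q-catchVal {v = v} {t = t} vᵛ 0∉v d) =
  transport (_ ⇛_) (sym (subst-lowerC τ t))
    (q-catchVal (Value-subst (proj₁ (⇛ˢ-shift R)) vᵛ) (0∉FCV-subst-shift σ v 0∉v)
      (⇛-subst (⇛ˢ-shift R) d))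
⇛-subst R (q-lrecNil vr vs d) =
  q-lrecNil (Value-subst (proj₁ R) vr) (Value-subst (proj₁ R) vs) (⇛-subst R d)
⇛-subst R (q-lrecCons vr vs vh vt dr ds dh dt) =
  q-lrecCons (Value-subst (proj₁ R) vr) (Value-subst (proj₁ R) vs)
    (Value-subst (proj₁ R) vh) (Value-subst (proj₁ R) vt)
    (⇛-subst R dr) (⇛-subst R ds) (⇛-subst R dh) (⇛-subst R dt)

ThrowsTo-subst R (th-here d)    = th-here (⇛-subst R d)
ThrowsTo-subst R (th-appL th)   = th-appL (ThrowsTo-subst R th)
ThrowsTo-subst R (th-appR v th) = th-appR (Value-subst (proj₁ R) v) (ThrowsTo-subst R th)
ThrowsTo-subst R (th-throw th)  = th-throw (ThrowsTo-subst R th)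

⇛-[0:=] : ∀ {t t′ r r′} → Value r → t ⇛ t′ → r ⇛ r′ → t [0:= r ] ⇛ t′ [0:= r′ ]
⇛-[0:=] {r = r} {r′ = r′} rᵛ d e = ⇛-subst (values , reductions) d
  where
  values : ∀ n → Value (single r n)
  values zero    = rᵛ
  values (suc n) = v-var
  reductions : ∀ n → single r n ⇛ single r′ n
  reductions zero    = e
  reductions (suc n) = q-var

Value-app⁻ : ∀ {t s} → Value (app t s) → Value t × Value s
Value-app⁻ (v-cons1 v)   = v-cons , v
Value-app⁻ (v-cons2 v w) = v-cons1 v , w
Value-app⁻ (v-lrec1 v)   = v-lrec , v
Value-app⁻ (v-lrec2 v w) = v-lrec1 v , w

value? : ∀ t → Dec (Value t)
value? (var x)     = yes v-var
value? unit        = yes v-unit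
value? nil         = yes v-nil
value? cons        = yes v-cons
value? lrec        = yes v-lrec
value? (lam t)     = yes v-lam
value? (catch t)   = no λ ()
value? (throw a t) = no λ ()
value? (app t s) with value? t | value? s
... | no ¬tᵛ | _      = no (¬tᵛ ∘ proj₁ ∘ Value-app⁻)
... | yes _  | no ¬sᵛ = no (¬sᵛ ∘ proj₂ ∘ Value-app⁻)
... | yes v-cons        | yes sᵛ = yes (v-cons1 sᵛ)
... | yes (v-cons1 v)   | yes sᵛ = yes (v-cons2 v sᵛ)
... | yes v-lrec        | yes sᵛ = yes (v-lrec1 sᵛ)
... | yes (v-lrec1 v)   | yes sᵛ = yes (v-lrec2 v sᵛ)
... | yes v-var         | yes _  = no λ ()
... | yes v-unit        | yes _  = no λ ()
... | yes v-nil         | yes _  = no λ ()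
... | yes (v-cons2 _ _) | yes _  = no λ ()
... | yes (v-lrec2 _ _) | yes _  = no λ ()
... | yes v-lam         | yes _  = no λ ()

_∈FCV?_ : ∀ a t → Dec (a ∈FCV t)
a ∈FCV? var x = no λ ()
a ∈FCV? unit  = no λ ()
a ∈FCV? nil   = no λ ()
a ∈FCV? cons  = no λ ()
a ∈FCV? lrec  = no λ ()
a ∈FCV? lam t with a ∈FCV? t
... | yes m = yes (fcv-lam m)
... | no ¬m = no λ { (fcv-lam m) → ¬m m }
a ∈FCV? app t s with a ∈FCV? t | a ∈FCV? s
... | yes m | _     = yes (fcv-appˡ m)
... | no _  | yes m = yes (fcv-appʳ m)
... | no ¬m | no ¬n = no λ { (fcv-appˡ m) → ¬m m ; (fcv-appʳ m) → ¬n m }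
a ∈FCV? catch t with suc a ∈FCV? t
... | yes m = yes (fcv-catch m)
... | no ¬m = no λ { (fcv-catch m) → ¬m m }
a ∈FCV? throw b t with a ≟ b | a ∈FCV? t
... | yes refl | _     = yes fcv-throw
... | no _     | yes m = yes (fcv-thrt m)
... | no a≢b   | no ¬m = no λ { fcv-throw → a≢b refl ; (fcv-thrt m) → ¬m m }

headThrow? : ∀ t → Dec (HeadThrow t)
headThrow? (throw a t) = yes ht-here
headThrow? (app t s) with headThrow? t | value? t | headThrow? s
... | yes h | _      | _     = yes (ht-appL h)
... | no ¬h | yes tᵛ | yes h = yes (ht-appR tᵛ h)
... | no ¬h | yes _  | no ¬k = no λ { (ht-appL h) → ¬h h ; (ht-appR _ k) → ¬k k }
... | no ¬h | no ¬tᵛ | _     = no λ { (ht-appL h) → ¬h h ; (ht-appR tᵛ _) → ¬tᵛ tᵛ }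
headThrow? (var _)   = no λ ()
headThrow? unit      = no λ ()
headThrow? nil       = no λ ()
headThrow? cons      = no λ ()
headThrow? lrec      = no λ ()
headThrow? (lam _)   = no λ ()
headThrow? (catch _) = no λ ()

data Redex : Term → Term → Set where
  rd-beta     : ∀ {t v} → Value v → Redex (lam t) v
  rd-lrecNil  : ∀ {vr vs} → Value vr → Value vs → Redex (app (app lrec vr) vs) nil
  rd-lrecCons : ∀ {vr vs vh vt} → Value vr → Value vs → Value vh → Value vt →
                Redex (app (app lrec vr) vs) (vh ∷ₜ vt)

Redex-Value : ∀ {t s} → Redex t s → Value t × Value s
Redex-Value (rd-beta v)             = v-lam , v
Redex-Value (rd-lrecNil vr vs)      = v-lrec2 vr vs , v-nil
Redex-Value (rd-lrecCons vr vs vh vt) = v-lrec2 vr vs , v-cons2 vh vt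

redex? : ∀ t s → Dec (Redex t s)
redex? t s with value? t | value? s
... | no ¬tᵛ | _      = no (¬tᵛ ∘ proj₁ ∘ Redex-Value)
... | yes _  | no ¬sᵛ = no (¬sᵛ ∘ proj₂ ∘ Redex-Value)
... | yes v-lam           | yes sᵛ             = yes (rd-beta sᵛ)
... | yes (v-lrec2 vr vs) | yes v-nil          = yes (rd-lrecNil vr vs)
... | yes (v-lrec2 vr vs) | yes (v-cons2 vh vt) = yes (rd-lrecCons vr vs vh vt)
... | yes (v-lrec2 _ _)   | yes v-var          = no λ ()
... | yes (v-lrec2 _ _)   | yes v-unit         = no λ ()
... | yes (v-lrec2 _ _)   | yes v-cons         = no λ ()
... | yes (v-lrec2 _ _)   | yes (v-cons1 _)    = no λ ()
... | yes (v-lrec2 _ _)   | yes v-lrec         = no λ ()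
... | yes (v-lrec2 _ _)   | yes (v-lrec1 _)    = no λ ()
... | yes (v-lrec2 _ _)   | yes (v-lrec2 _ _)  = no λ ()
... | yes (v-lrec2 _ _)   | yes v-lam          = no λ ()
... | yes v-var           | yes _ = no λ ()
... | yes v-unit          | yes _ = no λ ()
... | yes v-nil           | yes _ = no λ ()
... | yes v-cons          | yes _ = no λ ()
... | yes (v-cons1 _)     | yes _ = no λ ()
... | yes (v-cons2 _ _)   | yes _ = no λ ()
... | yes v-lrec          | yes _ = no λ ()
... | yes (v-lrec1 _)     | yes _ = no λ ()

Triangle : Term → Term → Set
Triangle t t* = ∀ {s} → t ⇛ s → s ⇛ t*

IsThrow : Term → Set
IsThrow t = Σ[ c ∈ ℕ ] Σ[ w ∈ Term ] t ≡ throw c w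

Value∌0 : Term → Set
Value∌0 v = Value v × ¬ (zero ∈FCV v)

NotThrow : Term → Set
NotThrow t = ∀ {a u} → ¬ (t ≡ throw a u)

triangle-lam : ∀ {t D} → Triangle t D → Triangle (lam t) (lam D)
triangle-lam △ (q-lam e) = q-lam (△ e)

-- An inner throw in head position overtakes the outer one: throw a E[throw c u] ⇛ throw c u′.
triangle-throw-HeadThrow : ∀ {a t D} → HeadThrow t → Triangle t D → IsThrow D → Triangle (throw a t) D
triangle-throw-HeadThrow h △ (_ , _ , refl) (q-throw (th-here e)) =
  q-throw (th-throw (⇛throw⇒ThrowsTo (⇛-HeadThrow h e) (△ e)))
triangle-throw-HeadThrow h △ _ (q-throw (th-throw th)) = △ (q-throw th)

triangle-throw : ∀ {a t D} → ¬ HeadThrow t → Triangle t D → Triangle (throw a t) (throw a D)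
triangle-throw ¬h △ (q-throw (th-here e))   = q-throw (th-here (△ e))
triangle-throw ¬h △ (q-throw (th-throw th)) = ⊥-elim (¬h (ThrowsTo⇒HeadThrow th))

triangle-catchThrow : ∀ {t D} → Triangle t D → Triangle (catch (throw zero t)) (catch D)
triangle-catchThrow △ (q-catch (q-throw (th-here e)))   = q-catchThrow (△ e)
triangle-catchThrow △ (q-catch (q-throw (th-throw th))) = q-catch (△ (q-throw th))
triangle-catchThrow △ (q-catchThrow e)                  = q-catch (△ e)

triangle-catchThrowOther : ∀ {b u D} → Value∌0 u → Triangle u D →
  Triangle (catch (throw (suc b) u)) (throw b (lowerC D))
triangle-catchThrowOther (uᵛ , 0∉u) △ (q-catch (q-throw (th-here e))) =
  q-catchThrowOther (⇛-Value uᵛ e) (0∉u ∘ ⇛-∈FCV⁻ e) (△ e)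
triangle-catchThrowOther (uᵛ , _) △ (q-catch (q-throw (th-throw th))) = ⊥-elim (Value⇒¬ThrowsTo uᵛ th)
triangle-catchThrowOther _ △ (q-catchThrowOther _ _ e) = q-throw (th-here (⇛-cren _ (△ e)))

triangle-catch-throwSuc : ∀ {b u D} → ¬ Value∌0 u → Triangle (throw (suc b) u) D →
  Triangle (catch (throw (suc b) u)) (catch D)
triangle-catch-throwSuc ¬u △ (q-catch e) = q-catch (△ e)
triangle-catch-throwSuc ¬u △ (q-catchThrowOther uᵛ 0∉u _) = ⊥-elim (¬u (uᵛ , 0∉u))

triangle-catchVal : ∀ {t D} → NotThrow t → Value∌0 t → Triangle t D → Triangle (catch t) (lowerC D)
triangle-catchVal _  (tᵛ , 0∉t) △ (q-catch e)        =
  q-catchVal (⇛-Value tᵛ e) (0∉t ∘ ⇛-∈FCV⁻ e) (△ e)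
triangle-catchVal _  _          △ (q-catchVal _ _ e) = ⇛-cren _ (△ e)
triangle-catchVal ≢t _          △ (q-catchThrow _)   = ⊥-elim (≢t refl)
triangle-catchVal ≢t _          △ (q-catchThrowOther _ _ _) = ⊥-elim (≢t refl)

triangle-catch : ∀ {t D} → NotThrow t → ¬ Value∌0 t → Triangle t D → Triangle (catch t) (catch D)
triangle-catch _  _  △ (q-catch e)                 = q-catch (△ e)
triangle-catch _  ¬t △ (q-catchVal tᵛ 0∉t _)       = ⊥-elim (¬t (tᵛ , 0∉t))
triangle-catch ≢t _  △ (q-catchThrow _)            = ⊥-elim (≢t refl)
triangle-catch ≢t _  △ (q-catchThrowOther _ _ _)   = ⊥-elim (≢t refl)

triangle-app-HeadThrowˡ : ∀ {t s D} → HeadThrow t → Triangle t D → IsThrow D → Triangle (app t s) D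
triangle-app-HeadThrowˡ h △ (_ , _ , refl) (q-app d _) =
  q-throw (th-appL (⇛throw⇒ThrowsTo (⇛-HeadThrow h d) (△ d)))
triangle-app-HeadThrowˡ h △ _ (q-throw (th-appL th))    = △ (q-throw th)
triangle-app-HeadThrowˡ h △ _ (q-throw (th-appR tᵛ _))  = ⊥-elim (Value⇒¬HeadThrow tᵛ h)
triangle-app-HeadThrowˡ h △ _ (q-lrecNil vr vs _)       = ⊥-elim (Value⇒¬HeadThrow (v-lrec2 vr vs) h)
triangle-app-HeadThrowˡ h △ _ (q-lrecCons vr vs _ _ _ _ _ _) = ⊥-elim (Value⇒¬HeadThrow (v-lrec2 vr vs) h)

triangle-app-HeadThrowʳ : ∀ {t s D} → Value t → HeadThrow s → Triangle s D → IsThrow D →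
  Triangle (app t s) D
triangle-app-HeadThrowʳ tᵛ h △ (_ , _ , refl) (q-app d e) =
  q-throw (th-appR (⇛-Value tᵛ d) (⇛throw⇒ThrowsTo (⇛-HeadThrow h e) (△ e)))
triangle-app-HeadThrowʳ tᵛ h △ _ (q-throw (th-appL th))   = ⊥-elim (Value⇒¬ThrowsTo tᵛ th)
triangle-app-HeadThrowʳ tᵛ h △ _ (q-throw (th-appR _ th)) = △ (q-throw th)
triangle-app-HeadThrowʳ tᵛ h △ _ (q-beta sᵛ _ _)          = ⊥-elim (Value⇒¬HeadThrow sᵛ h)
triangle-app-HeadThrowʳ tᵛ h △ _ (q-lrecCons _ _ vh vt _ _ _ _) =
  ⊥-elim (Value⇒¬HeadThrow (v-cons2 vh vt) h)

triangle-beta : ∀ {t s D E} → Value s → Triangle t D → Triangle s E →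
  Triangle (app (lam t) s) (D [0:= E ])
triangle-beta sᵛ △t △s (q-app (q-lam d) e) = q-beta (⇛-Value sᵛ e) (△t d) (△s e)
triangle-beta sᵛ △t △s (q-beta _ d e)      = ⇛-[0:=] (⇛-Value sᵛ e) (△t d) (△s e)
triangle-beta sᵛ △t △s (q-throw (th-appR _ th)) = ⊥-elim (Value⇒¬ThrowsTo sᵛ th)

triangle-lrecNil : ∀ {vr vs D} → Value vr → Value vs → Triangle vr D →
  Triangle (app (app (app lrec vr) vs) nil) D
triangle-lrecNil vr vs △ (q-app (q-app (q-app q-lrec dr) ds) q-nil) =
  q-lrecNil (⇛-Value vr dr) (⇛-Value vs ds) (△ dr)
triangle-lrecNil vr vs △ (q-app (q-app (q-throw th) _) q-nil) = ⊥-elim (Value⇒¬ThrowsTo (v-lrec1 vr) th)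
triangle-lrecNil vr vs △ (q-app (q-throw th) q-nil)           = ⊥-elim (Value⇒¬ThrowsTo (v-lrec2 vr vs) th)
triangle-lrecNil vr vs △ (q-lrecNil _ _ dr)                   = △ dr
triangle-lrecNil vr vs △ (q-throw (th-appL th))               = ⊥-elim (Value⇒¬ThrowsTo (v-lrec2 vr vs) th)

triangle-lrecCons : ∀ {vr vs vh vt Dr Ds Dh Dt} → Value vr → Value vs → Value vh → Value vt →
  Triangle vr Dr → Triangle vs Ds → Triangle vh Dh → Triangle vt Dt →
  Triangle (app (app (app lrec vr) vs) (vh ∷ₜ vt)) (app (app (app Ds Dh) Dt) (app (app (app lrec Dr) Ds) Dt))
triangle-lrecCons vr vs vh vt △r △s △h △t (q-app (q-app (q-app q-lrec dr) ds) (q-app (q-app q-cons dh) dt)) =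
  q-lrecCons (⇛-Value vr dr) (⇛-Value vs ds) (⇛-Value vh dh) (⇛-Value vt dt)
    (△r dr) (△s ds) (△h dh) (△t dt)
triangle-lrecCons vr vs vh vt △r △s △h △t (q-lrecCons _ _ _ _ dr ds dh dt) =
  q-app (q-app (q-app (△s ds) (△h dh)) (△t dt)) (q-app (q-app (q-app q-lrec (△r dr)) (△s ds)) (△t dt))
triangle-lrecCons vr vs vh vt _ _ _ _ (q-app (q-app (q-throw th) _) _) = ⊥-elim (Value⇒¬ThrowsTo (v-lrec1 vr) th)
triangle-lrecCons vr vs vh vt _ _ _ _ (q-app (q-throw th) _)  = ⊥-elim (Value⇒¬ThrowsTo (v-lrec2 vr vs) th)
triangle-lrecCons vr vs vh vt _ _ _ _ (q-app _ (q-app (q-throw th) _)) = ⊥-elim (Value⇒¬ThrowsTo (v-cons1 vh) th)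
triangle-lrecCons vr vs vh vt _ _ _ _ (q-app _ (q-throw th))  = ⊥-elim (Value⇒¬ThrowsTo (v-cons2 vh vt) th)
triangle-lrecCons vr vs vh vt _ _ _ _ (q-throw (th-appL th))   = ⊥-elim (Value⇒¬ThrowsTo (v-lrec2 vr vs) th)
triangle-lrecCons vr vs vh vt _ _ _ _ (q-throw (th-appR _ th)) = ⊥-elim (Value⇒¬ThrowsTo (v-cons2 vh vt) th)

triangle-app : ∀ {t s D E} → ¬ HeadThrow (app t s) → ¬ Redex t s → Triangle t D → Triangle s E →
  Triangle (app t s) (app D E)
triangle-app ¬h ¬r △t △s (q-app d e)             = q-app (△t d) (△s e)
triangle-app ¬h ¬r △t △s (q-throw th)            = ⊥-elim (¬h (ThrowsTo⇒HeadThrow th))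
triangle-app ¬h ¬r △t △s (q-beta sᵛ _ _)         = ⊥-elim (¬r (rd-beta sᵛ))
triangle-app ¬h ¬r △t △s (q-lrecNil vr vs _)     = ⊥-elim (¬r (rd-lrecNil vr vs))
triangle-app ¬h ¬r △t △s (q-lrecCons vr vs vh vt _ _ _ _) = ⊥-elim (¬r (rd-lrecCons vr vs vh vt))

record Development (t : Term) : Set where
  constructor mkDevelopment
  field
    dev        : Term
    triangle   : Triangle t dev
    dev-throws : HeadThrow t → IsThrow dev
open Development

develop-throw : ∀ a t → Development t → Development (throw a t)
develop-throw a t Dt with headThrow? t
... | yes h =
  mkDevelopment (dev Dt) (triangle-throw-HeadThrow h (triangle Dt) (dev-throws Dt h)) λ _ → dev-throws Dt h
... | no ¬h = mkDevelopment (throw a (dev Dt)) (triangle-throw ¬h (triangle Dt)) λ _ → a , _ , refl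

develop-catch-throwSuc : ∀ b u → Development u → Development (throw (suc b) u) →
  Development (catch (throw (suc b) u))
develop-catch-throwSuc b u Du Dthrow with value? u ×-dec ¬? (zero ∈FCV? u)
... | yes u∌0 = mkDevelopment (throw b (lowerC (dev Du))) (triangle-catchThrowOther u∌0 (triangle Du)) λ ()
... | no ¬u∌0 = mkDevelopment (catch (dev Dthrow)) (triangle-catch-throwSuc ¬u∌0 (triangle Dthrow)) λ ()

develop-catch : ∀ t → NotThrow t → Development t → Development (catch t)
develop-catch t ≢t Dt with value? t ×-dec ¬? (zero ∈FCV? t)
... | yes t∌0 = mkDevelopment (lowerC (dev Dt)) (triangle-catchVal ≢t t∌0 (triangle Dt)) λ ()
... | no ¬t∌0 = mkDevelopment (catch (dev Dt)) (triangle-catch ≢t ¬t∌0 (triangle Dt)) λ ()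

develop : ∀ t → Development t
develop (var x) = mkDevelopment (var x) (λ { q-var → q-var }) λ ()
develop unit    = mkDevelopment unit (λ { q-unit → q-unit }) λ ()
develop nil     = mkDevelopment nil (λ { q-nil → q-nil }) λ ()
develop cons    = mkDevelopment cons (λ { q-cons → q-cons }) λ ()
develop lrec    = mkDevelopment lrec (λ { q-lrec → q-lrec }) λ ()
develop (lam t) = mkDevelopment (lam (dev (develop t))) (triangle-lam (triangle (develop t))) λ ()
develop (throw a t) = develop-throw a t (develop t)
develop (catch (throw zero t)) =
  mkDevelopment (catch (dev (develop t))) (triangle-catchThrow (triangle (develop t))) λ ()
develop (catch (throw (suc b) u)) = develop-catch-throwSuc b u (develop u) (develop (throw (suc b) u))
develop (catch (var x))   = develop-catch (var x) (λ ()) (develop (var x))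
develop (catch unit)      = develop-catch unit (λ ()) (develop unit)
develop (catch nil)       = develop-catch nil (λ ()) (develop nil)
develop (catch cons)      = develop-catch cons (λ ()) (develop cons)
develop (catch lrec)      = develop-catch lrec (λ ()) (develop lrec)
develop (catch (lam t))   = develop-catch (lam t) (λ ()) (develop (lam t))
develop (catch (app t s)) = develop-catch (app t s) (λ ()) (develop (app t s))
develop (catch (catch t)) = develop-catch (catch t) (λ ()) (develop (catch t))
develop (app t s) with headThrow? (app t s)
... | yes (ht-appL h) =
  mkDevelopment (dev Dt) (triangle-app-HeadThrowˡ h (triangle Dt) (dev-throws Dt h)) λ _ → dev-throws Dt h
  where Dt = develop t
... | yes (ht-appR tᵛ h) =
  mkDevelopment (dev Ds) (triangle-app-HeadThrowʳ tᵛ h (triangle Ds) (dev-throws Ds h)) λ _ → dev-throws Ds h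
  where Ds = develop s
... | no ¬h with redex? t s
...   | no ¬r = mkDevelopment (app (dev (develop t)) (dev (develop s)))
                  (triangle-app ¬h ¬r (triangle (develop t)) (triangle (develop s))) (⊥-elim ∘ ¬h)
...   | yes (rd-beta {t = t₀} sᵛ) = mkDevelopment (dev (develop t₀) [0:= dev (develop s) ])
                  (triangle-beta sᵛ (triangle (develop t₀)) (triangle (develop s))) (⊥-elim ∘ ¬h)
...   | yes (rd-lrecNil {vr} vrᵛ vsᵛ) = mkDevelopment (dev (develop vr))
                  (triangle-lrecNil vrᵛ vsᵛ (triangle (develop vr))) (⊥-elim ∘ ¬h)
...   | yes (rd-lrecCons {vr} {vs} {vh} {vt} vrᵛ vsᵛ vhᵛ vtᵛ) = mkDevelopment
                  (app (app (app (dev Ds) (dev Dh)) (dev Dt)) (app (app (app lrec (dev Dr)) (dev Ds)) (dev Dt)))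
                  (triangle-lrecCons vrᵛ vsᵛ vhᵛ vtᵛ (triangle Dr) (triangle Ds) (triangle Dh) (triangle Dt))
                  (⊥-elim ∘ ¬h)
  where
  Dr = develop vr
  Ds = develop vs
  Dh = develop vh
  Dt = develop vt

corollary3p9 : (t₁ t₂ t₃ : Term) → t₁ ⇒ t₂ → t₁ ⇒ t₃ →
    Σ Term (λ t₄ → (t₂ ⇒ t₄) × (t₃ ⇒ t₄))
corollary3p9 t₁ t₂ t₃ d₂ d₃ =
  dev D , ⇛-to-⇒ (triangle D (⇒-to-⇛ d₂)) , ⇛-to-⇒ (triangle D (⇒-to-⇛ d₃))
  where D = develop t₁
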